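{- Let $n\ge1$, $q\in\mathbf Q_{>0}$. For disjoint subsets $J,K\subseteq[n]$, the cone $\sigma_{J,K}$ is a strongly convex rational polyhedral cone in $\mathbf R^n$ of dimension $\#J+\#K$. Moreover, for disjoint $J,K\subseteq[n]$ and disjoint $P,Q\subseteq[n]$, we have $\sigma_{J,K}\cap\sigma_{P,Q}=\sigma_{J\cap P,K\cap Q}$.
   Context: Let $A=A(n,q)$ be the $n\times n$ tridiagonal matrix with $A_{ii}=q+1$, $A_{i,i+1}=-1$, $A_{i+1,i}=-q$, other entries $0$, and let $\alpha_1,\dots,\alpha_n\in\mathbf Q^n$ be its columns; $e_1,\dots,e_n$ is the standard basis of $\mathbf Z^n$. For disjoint $J,K\subseteq[n]$ set $\sigma_{J,K}=\mathrm{cone}\{e_i:i\in J\}-\mathrm{cone}\{\alpha_k:k\in K\}=\mathrm{cone}(\{e_i\}_{i\in J}\cup\{ -\alpha_k\}_{k\in K})$, with $\mathrm{cone}\,\emptyset=\{0\}$.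
   Formalization: Each cone $\sigma_{J,K}$ is taken as its set of points with rational coordinates, a subset of ℚ^n rather than of $\mathbf R^n$. -}

module Defs where

open import Data.Nat as ℕ using (ℕ; zero; suc)
open import Data.Bool using (if_then_else_)
open import Data.Fin using (Fin; toℕ)
open import Data.Fin.Subset using (Subset; _∈_; _∩_; Empty; ∣_∣)
open import Data.Fin.Subset.Properties using (_∈?_)
open import Data.List as List using (List; _++_; allFin; filter; length; lookup)
open import Data.Rational using (ℚ; 0ℚ; 1ℚ; _+_; _*_; -_; _≤_)
open import Data.Product using (Σ; ∃; _×_)
open import Relation.Binary.PropositionalEquality using (_≡_)
open import Relation.Nullary using (does)

Vector : ℕ → Set
Vector n = Fin n → ℚ

VSet : ℕ → Set₁
VSet n = Vector n → Set

sumFin : ∀ m → (Fin m → ℚ) → ℚ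
sumFin zero    f = 0ℚ
sumFin (suc m) f = f Fin.zero + sumFin m (λ j → f (Fin.suc j))

lincomb : ∀ {n m} → (Fin m → ℚ) → (Fin m → Vector n) → Vector n
lincomb {m = m} c v i = sumFin m (λ j → c j * v j i)

Cone : ∀ {n m} → (Fin m → Vector n) → VSet n
Cone {n} {m} g x = ∃ λ (c : Fin m → ℚ) → (∀ j → 0ℚ ≤ c j) × (∀ i → x i ≡ lincomb c g i)

e : ∀ {n} → Fin n → Vector n
e k i = if does (toℕ i ℕ.≟ toℕ k) then 1ℚ else 0ℚ

A : ∀ {n} → ℚ → Fin n → Fin n → ℚ
A q i j =
  if does (toℕ i ℕ.≟ toℕ j) then q + 1ℚ
  else if does (suc (toℕ i) ℕ.≟ toℕ j) then - 1ℚ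
  else if does (toℕ i ℕ.≟ suc (toℕ j)) then - q
  else 0ℚ

α : ∀ {n} → ℚ → Fin n → Vector n
α q k i = A q i k

negV : ∀ {n} → Vector n → Vector n
negV v i = - v i

gensList : ∀ {n} → ℚ → Subset n → Subset n → List (Vector n)
gensList {n} q J K =
  List.map e (filter (_∈? J) (allFin n)) ++
  List.map (λ k → negV (α q k)) (filter (_∈? K) (allFin n))

-- σ_{J,K} = cone({e_i}_{i∈J} ∪ {-α_k}_{k∈K})  (cone ∅ = {0})
σ : ∀ {n} → ℚ → Subset n → Subset n → VSet n
σ q J K = Cone (lookup (gensList q J K))

Disjoint : ∀ {n} → Subset n → Subset n → Set
Disjoint J K = Empty (J ∩ K)

_≐_ : ∀ {n} → VSet n → VSet n → Set
S ≐ T = ∀ x → (S x → T x) × (T x → S x)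

_∩ᵥ_ : ∀ {n} → VSet n → VSet n → VSet n
(S ∩ᵥ T) x = S x × T x

StronglyConvex : ∀ {n} → VSet n → Set
StronglyConvex S = ∀ x → S x → S (negV x) → ∀ i → x i ≡ 0ℚ

RationalPolyhedral : ∀ {n} → VSet n → Set
RationalPolyhedral {n} S = ∃ λ m → ∃ λ (g : Fin m → Vector n) → S ≐ Cone g

LinSpan : ∀ {n} → VSet n → VSet n
LinSpan {n} S x = ∃ λ m → ∃ λ (c : Fin m → ℚ) → ∃ λ (v : Fin m → Vector n) →
  (∀ j → S (v j)) × (∀ i → x i ≡ lincomb c v i)

LinIndep : ∀ {n d} → (Fin d → Vector n) → Set
LinIndep {d = d} b = ∀ (c : Fin d → ℚ) → (∀ i → lincomb c b i ≡ 0ℚ) → ∀ j → c j ≡ 0ℚ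

HasDim : ∀ {n} → VSet n → ℕ → Set
HasDim {n} S d = ∃ λ (b : Fin d → Vector n) →
  (∀ j → LinSpan S (b j)) × LinIndep b ×
  (∀ x → LinSpan S x → ∃ λ (c : Fin d → ℚ) → ∀ i → x i ≡ lincomb c b i)

-- The matrix A reverses the sign of no nonzero vector: y_i (A y)_i ≤ 0 for all i forces y = 0.
-- Pad y with y_0 = y_{n+1} = 0, so that (A y)_i = (q+1) y_i − y_{i+1} − q y_{i−1}. Then
-- y_i (A y)_i ≤ 0 and 2 y_i y_j ≤ y_i² + y_j² give (q+1) y_i² ≤ y_{i+1}² + q y_{i−1}², so by induction
-- the squares y_i² are nondecreasing; they start and end at 0, hence all vanish.
--
-- Every x ∈ σ_{J,K} has the form x = a − A b with a ≥ 0 supported in J and b ≥ 0 supported in K, so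
-- a_i b_i = 0. Two such forms (a, b) and (c, d) of one x give a − c = A (b − d) and
-- (b_i − d_i)(a_i − c_i) = −(b_i c_i + d_i a_i) ≤ 0, so b = d and a = c, as for a linear
-- complementarity problem with a P-matrix. This gives the intersection formula; for x and −x
-- (where a + a′ = A (b + b′)) it gives strong convexity, and for a vanishing combination of the
-- generators their linear independence, whence dim σ_{J,K} = #J + #K.
{-# OPTIONS --safe #-}
module Submission where

open import Defs

open import Algebra.Bundles using (CommutativeRing)
open import Data.Bool using (true; false; if_then_else_)
open import Data.Empty using (⊥-elim)
open import Data.Fin as Fin using (Fin; toℕ; zero; suc)
import Data.Fin.Properties as Finₚ
open import Data.Fin.Subset using (Subset; inside; outside; _∉_; _∩_; _⊆_; ∣_∣)
open import Data.Fin.Subset.Properties using (_∈?_; drop-there; x∈p∩q⁺; p∩q⊆p; p∩q⊆q)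
open import Data.List as List using (List; _++_; filter; allFin; tabulate; length; lookup)
open import Data.List.Properties using (map-tabulate; map-∘; length-++)
open import Data.Nat as ℕ using (ℕ; zero; suc)
import Data.Nat.Properties as ℕₚ
open import Data.Product using (∃; _×_; _,_; proj₁; proj₂)
open import Data.Rational hiding (∣_∣)
open import Data.Rational.Properties
open import Data.Rational.Solver using (module +-*-Solver)
open import Data.Sum using (inj₁; inj₂)
open import Data.Vec using ([]; _∷_; here; there)
open import Data.Vec.Functional as VF using (map)
open import Data.Vec.Functional.Relation.Unary.All using (All)
open import Function using (_∘_; id)
open import Level using (Level)
open import Relation.Binary.Definitions using (tri<; tri≈; tri>)
open import Relation.Binary.PropositionalEquality
open import Relation.Nullary using (does; yes; no; contradiction)
open import Relation.Unary using (Pred)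

open import Algebra.Properties.Group +-0-group using (x∙y⁻¹≈ε⇒x≈y)
open import Algebra.Properties.Semiring.Sum (CommutativeRing.semiring +-*-commutativeRing)
  using (sum; sum-cong-≗; ∑-distrib-+; ∑-comm; *-distribˡ-sum; *-distribʳ-sum; sum-replicate-zero)
open +-*-Solver
open ≡-Reasoning

private variable
  ℓ : Level
  T : Set ℓ
  m n p : ℕ

-- Linear combinations

sumFin≡sum : ∀ m (f : Fin m → ℚ) → sumFin m f ≡ sum f
sumFin≡sum zero    f = refl
sumFin≡sum (suc m) f = cong (f zero +_) (sumFin≡sum m (f ∘ suc))

sum-zeros : {f : Fin m → ℚ} → (∀ j → f j ≡ 0ℚ) → sum f ≡ 0ℚ
sum-zeros {m = m} f≡0 = trans (sum-cong-≗ f≡0) (sum-replicate-zero m)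

lincomb≡sum : (c : Fin m → ℚ) (v : Fin m → Vector n) → ∀ i → lincomb c v i ≡ sum (λ j → c j * v j i)
lincomb≡sum {m = m} c v i = sumFin≡sum m (λ j → c j * v j i)

lincomb-cong : {c d : Fin m → ℚ} {v w : Fin m → Vector n} →
  (∀ j → c j ≡ d j) → (∀ j i → v j i ≡ w j i) → ∀ i → lincomb c v i ≡ lincomb d w i
lincomb-cong {c = c} {d} {v} {w} c≗d v≗w i = begin
  lincomb c v i            ≡⟨ lincomb≡sum c v i ⟩
  sum (λ j → c j * v j i)  ≡⟨ sum-cong-≗ (λ j → cong₂ _*_ (c≗d j) (v≗w j i)) ⟩
  sum (λ j → d j * w j i)  ≡⟨ lincomb≡sum d w i ⟨
  lincomb d w i            ∎

lincomb-zero : (c : Fin m → ℚ) (v : Fin m → Vector n) → (∀ j → c j ≡ 0ℚ) → ∀ i → lincomb c v i ≡ 0ℚ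
lincomb-zero c v c≡0 i =
  trans (lincomb≡sum c v i) (sum-zeros (λ j → trans (cong (_* v j i) (c≡0 j)) (*-zeroˡ (v j i))))

lincomb-head-zero : (c : Fin (suc m) → ℚ) (v : Fin (suc m) → Vector n) → c zero ≡ 0ℚ →
  ∀ i → lincomb c v i ≡ lincomb (c ∘ suc) (v ∘ suc) i
lincomb-head-zero c v c₀≡0 i = begin
  c zero * v zero i + rest  ≡⟨ cong (λ t → t * v zero i + rest) c₀≡0 ⟩
  0ℚ * v zero i + rest      ≡⟨ cong (_+ rest) (*-zeroˡ (v zero i)) ⟩
  0ℚ + rest                 ≡⟨ +-identityˡ rest ⟩
  rest                      ∎
  where rest = lincomb (c ∘ suc) (v ∘ suc) i

lincomb-+ : (c d : Fin m → ℚ) (v : Fin m → Vector n) →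
  ∀ i → lincomb (λ j → c j + d j) v i ≡ lincomb c v i + lincomb d v i
lincomb-+ c d v i = begin
  lincomb (λ j → c j + d j) v i
    ≡⟨ lincomb≡sum (λ j → c j + d j) v i ⟩
  sum (λ j → (c j + d j) * v j i)
    ≡⟨ sum-cong-≗ (λ j → *-distribʳ-+ (v j i) (c j) (d j)) ⟩
  sum (λ j → c j * v j i + d j * v j i)
    ≡⟨ ∑-distrib-+ (λ j → c j * v j i) (λ j → d j * v j i) ⟩
  sum (λ j → c j * v j i) + sum (λ j → d j * v j i)
    ≡⟨ cong₂ _+_ (lincomb≡sum c v i) (lincomb≡sum d v i) ⟨
  lincomb c v i + lincomb d v i ∎

lincomb-scale : (t : ℚ) (c : Fin m → ℚ) (v : Fin m → Vector n) →
  ∀ i → lincomb (λ j → t * c j) v i ≡ t * lincomb c v i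
lincomb-scale t c v i = begin
  lincomb (λ j → t * c j) v i           ≡⟨ lincomb≡sum (λ j → t * c j) v i ⟩
  sum (λ j → t * c j * v j i)           ≡⟨ sum-cong-≗ (λ j → *-assoc t (c j) (v j i)) ⟩
  sum (map (t *_) (λ j → c j * v j i))  ≡⟨ *-distribˡ-sum t (λ j → c j * v j i) ⟨
  t * sum (λ j → c j * v j i)           ≡⟨ cong (t *_) (lincomb≡sum c v i) ⟨
  t * lincomb c v i                     ∎

lincomb-neg : (c : Fin m → ℚ) (v : Fin m → Vector n) → ∀ i → lincomb (λ j → - c j) v i ≡ - lincomb c v i
lincomb-neg c v i = begin
  lincomb (λ j → - c j) v i       ≡⟨ lincomb-cong {v = v} (λ j → -p≡-1*p (c j)) (λ _ _ → refl) i ⟩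
  lincomb (λ j → - 1ℚ * c j) v i  ≡⟨ lincomb-scale (- 1ℚ) c v i ⟩
  - 1ℚ * lincomb c v i            ≡⟨ -p≡-1*p (lincomb c v i) ⟨
  - lincomb c v i                 ∎
  where
  -p≡-1*p : ∀ p → - p ≡ - 1ℚ * p
  -p≡-1*p p = trans (cong -_ (sym (*-identityˡ p))) (neg-distribˡ-* 1ℚ p)

lincomb-negV : (c : Fin m → ℚ) (v : Fin m → Vector n) →
  ∀ i → lincomb c (λ j → negV (v j)) i ≡ - lincomb c v i
lincomb-negV c v i = begin
  lincomb c (λ j → negV (v j)) i  ≡⟨ lincomb≡sum c (λ j → negV (v j)) i ⟩
  sum (λ j → c j * - v j i)       ≡⟨ sum-cong-≗ (λ j → trans (sym (neg-distribʳ-* (c j) (v j i)))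
                                                             (neg-distribˡ-* (c j) (v j i))) ⟩
  sum (λ j → - c j * v j i)       ≡⟨ lincomb≡sum (λ j → - c j) v i ⟨
  lincomb (λ j → - c j) v i       ≡⟨ lincomb-neg c v i ⟩
  - lincomb c v i                 ∎

lincomb-sub : (c d : Fin m → ℚ) (v : Fin m → Vector n) →
  ∀ i → lincomb (λ j → c j - d j) v i ≡ lincomb c v i - lincomb d v i
lincomb-sub c d v i = trans (lincomb-+ c (λ j → - d j) v i) (cong (lincomb c v i +_) (lincomb-neg d v i))

lincomb-lincomb : (c : Fin p → ℚ) (D : Fin p → Fin m → ℚ) (g : Fin m → Vector n) →
  ∀ i → lincomb c (λ j → lincomb (D j) g) i ≡ lincomb (λ k → sum (λ j → c j * D j k)) g i
lincomb-lincomb c D g i = begin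
  lincomb c (λ j → lincomb (D j) g) i
    ≡⟨ trans (lincomb≡sum c (λ j → lincomb (D j) g) i)
             (sum-cong-≗ (λ j → cong (c j *_) (lincomb≡sum (D j) g i))) ⟩
  sum (λ j → c j * sum (λ k → D j k * g k i))
    ≡⟨ sum-cong-≗ (λ j → trans (*-distribˡ-sum (c j) (λ k → D j k * g k i))
                               (sum-cong-≗ (λ k → sym (*-assoc (c j) (D j k) (g k i))))) ⟩
  sum (λ j → sum (λ k → c j * D j k * g k i))
    ≡⟨ ∑-comm (λ j k → c j * D j k * g k i) ⟩
  sum (λ k → sum (λ j → c j * D j k * g k i))
    ≡⟨ sum-cong-≗ (λ k → *-distribʳ-sum (g k i) (λ j → c j * D j k)) ⟨
  sum (λ k → sum (λ j → c j * D j k) * g k i)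
    ≡⟨ lincomb≡sum (λ k → sum (λ j → c j * D j k)) g i ⟨
  lincomb (λ k → sum (λ j → c j * D j k)) g i ∎

indicator : ℕ → ℕ → ℚ → ℚ
indicator j k v = if does (j ℕ.≟ k) then v else 0ℚ

extend : (Fin m → ℚ) → ℕ → ℚ
extend {m = zero}  g j       = 0ℚ
extend {m = suc m} g zero    = g zero
extend {m = suc m} g (suc j) = extend (g ∘ suc) j

extend-toℕ : (g : Fin m → ℚ) → ∀ k → extend g (toℕ k) ≡ g k
extend-toℕ g zero    = refl
extend-toℕ g (suc k) = extend-toℕ (g ∘ suc) k

extend-beyond : ∀ m (g : Fin m → ℚ) → extend g m ≡ 0ℚ
extend-beyond zero    g = refl
extend-beyond (suc m) g = extend-beyond m (g ∘ suc)

sum-indicator : ∀ m (g : Fin m → ℚ) j v → sum (λ k → g k * indicator j (toℕ k) v) ≡ extend g j * v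
sum-indicator zero    g j       v = sym (*-zeroˡ v)
sum-indicator (suc m) g zero    v = begin
  g zero * v + sum (λ k → g (suc k) * 0ℚ)  ≡⟨ cong (g zero * v +_) (sum-zeros (λ k → *-zeroʳ (g (suc k)))) ⟩
  g zero * v + 0ℚ                          ≡⟨ +-identityʳ (g zero * v) ⟩
  g zero * v                               ∎
sum-indicator (suc m) g (suc j) v = begin
  g zero * 0ℚ + rest      ≡⟨ cong (_+ rest) (*-zeroʳ (g zero)) ⟩
  0ℚ + rest               ≡⟨ +-identityˡ rest ⟩
  rest                    ≡⟨ sum-indicator m (g ∘ suc) j v ⟩
  extend (g ∘ suc) j * v  ∎
  where rest = sum (λ k → g (suc k) * indicator j (toℕ k) v)

e-sym : (j k : Fin n) → e j k ≡ e k j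
e-sym zero    zero    = refl
e-sym zero    (suc k) = refl
e-sym (suc j) zero    = refl
e-sym (suc j) (suc k) = e-sym j k

lincomb-e : (a : Fin n → ℚ) → ∀ i → lincomb a e i ≡ a i
lincomb-e {n = n} a i = begin
  lincomb a e i            ≡⟨ lincomb≡sum a e i ⟩
  sum (λ k → a k * e k i)  ≡⟨ sum-indicator n a (toℕ i) 1ℚ ⟩
  extend a (toℕ i) * 1ℚ    ≡⟨ *-identityʳ (extend a (toℕ i)) ⟩
  extend a (toℕ i)         ≡⟨ extend-toℕ a i ⟩
  a i                      ∎

lincomb-unit : (g : Fin m → Vector n) → ∀ j i → lincomb (e j) g i ≡ g j i
lincomb-unit {m = m} g j i = begin
  lincomb (e j) g i                  ≡⟨ lincomb≡sum (e j) g i ⟩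
  sum (λ k → e j k * g k i)          ≡⟨ sum-cong-≗ (λ k → trans (cong (_* g k i) (e-sym j k))
                                                                (*-comm (e k j) (g k i))) ⟩
  sum (λ k → g k i * e k j)          ≡⟨ sum-indicator m (λ k → g k i) (toℕ j) 1ℚ ⟩
  extend (λ k → g k i) (toℕ j) * 1ℚ  ≡⟨ *-identityʳ (extend (λ k → g k i) (toℕ j)) ⟩
  extend (λ k → g k i) (toℕ j)       ≡⟨ extend-toℕ (λ k → g k i) j ⟩
  g j i                              ∎

e-nonneg : (j k : Fin m) → 0ℚ ≤ e j k
e-nonneg j k with does (toℕ k ℕ.≟ toℕ j)
... | true  = nonNegative⁻¹ 1ℚ
... | false = ≤-refl

generator∈Cone : (g : Fin m → Vector n) → ∀ j → Cone g (g j)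
generator∈Cone g j = e j , e-nonneg j , λ i → sym (lincomb-unit g j i)

LinIndep⇒HasDim-Cone : (g : Fin m → Vector n) → LinIndep g → HasDim (Cone g) m
LinIndep⇒HasDim-Cone {m = m} g indep = g , g∈span , indep , spanned
  where
  g∈span : ∀ j → LinSpan (Cone g) (g j)
  g∈span j = 1 , (λ _ → 1ℚ) , (λ _ → g j) , (λ _ → generator∈Cone g j) ,
             λ i → sym (trans (+-identityʳ (1ℚ * g j i)) (*-identityˡ (g j i)))
  spanned : ∀ x → LinSpan (Cone g) x → ∃ λ (c : Fin m → ℚ) → ∀ i → x i ≡ lincomb c g i
  spanned x (p , c , v , v∈Cone , x≡cv) = (λ k → sum (λ j → c j * D j k)) , λ i → begin
    x i                                          ≡⟨ x≡cv i ⟩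
    lincomb c v i                                ≡⟨ lincomb-cong {c = c} (λ _ → refl) v≡Dg i ⟩
    lincomb c (λ j → lincomb (D j) g) i          ≡⟨ lincomb-lincomb c D g i ⟩
    lincomb (λ k → sum (λ j → c j * D j k)) g i  ∎
    where
    D : Fin p → Fin m → ℚ
    D j = proj₁ (v∈Cone j)
    v≡Dg : ∀ j i → v j i ≡ lincomb (D j) g i
    v≡Dg j = proj₂ (proj₂ (v∈Cone j))

-- The matrix A reverses the sign of no nonzero vector

applyA : ℚ → (Fin n → ℚ) → Vector n
applyA q b = lincomb b (α q)

rowA : ℚ → ℚ → ℚ → ℚ → ℚ
rowA q w₋ w w₊ = w * (q + 1ℚ) + w₊ * (- 1ℚ) + w₋ * (- q)

-- padded g (1 + i) = g i, with padded g 0 = padded g (1 + m) = 0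
padded : (Fin m → ℚ) → ℕ → ℚ
padded g zero    = 0ℚ
padded g (suc j) = extend g j

sum-indicator-pred : ∀ m (g : Fin m → ℚ) j v → sum (λ k → g k * indicator j (suc (toℕ k)) v) ≡ padded g j * v
sum-indicator-pred m g zero    v = trans (sum-zeros (λ k → *-zeroʳ (g k))) (sym (*-zeroˡ v))
sum-indicator-pred m g (suc j) v = sum-indicator m g j v

A-indicators : ∀ q (i k : Fin n) → A q i k ≡ indicator (toℕ i) (toℕ k) (q + 1ℚ)
                                             + indicator (suc (toℕ i)) (toℕ k) (- 1ℚ)
                                             + indicator (toℕ i) (suc (toℕ k)) (- q)
A-indicators q zero          zero          = sym (trans (+-identityʳ _) (+-identityʳ (q + 1ℚ)))
A-indicators q zero          (suc zero)    = sym (trans (+-identityʳ _) (+-identityˡ (- 1ℚ)))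
A-indicators q zero          (suc (suc k)) = refl
A-indicators q (suc zero)    zero          = sym (+-identityˡ (- q))
A-indicators q (suc (suc i)) zero          = refl
A-indicators q (suc i)       (suc k)       = A-indicators q i k

applyA-padded : ∀ q (y : Fin n → ℚ) i →
  applyA q y i ≡ rowA q (padded y (toℕ i)) (padded y (suc (toℕ i))) (padded y (suc (suc (toℕ i))))
applyA-padded {n = n} q y i = begin
  applyA q y i
    ≡⟨ lincomb≡sum y (α q) i ⟩
  sum (λ k → y k * A q i k)
    ≡⟨ sum-cong-≗ (λ k → trans (cong (y k *_) (A-indicators q i k))
                               (*-distribˡ-+₃ (y k) (I₀ k) (I₊ k) (I₋ k))) ⟩
  sum (λ k → y k * I₀ k + y k * I₊ k + y k * I₋ k)
    ≡⟨ trans (∑-distrib-+ (λ k → y k * I₀ k + y k * I₊ k) (λ k → y k * I₋ k))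
             (cong (_+ sum (λ k → y k * I₋ k)) (∑-distrib-+ (λ k → y k * I₀ k) (λ k → y k * I₊ k))) ⟩
  sum (λ k → y k * I₀ k) + sum (λ k → y k * I₊ k) + sum (λ k → y k * I₋ k)
    ≡⟨ cong₂ _+_ (cong₂ _+_ (sum-indicator n y (toℕ i) (q + 1ℚ)) (sum-indicator n y (suc (toℕ i)) (- 1ℚ)))
                 (sum-indicator-pred n y (toℕ i) (- q)) ⟩
  rowA q (padded y (toℕ i)) (padded y (suc (toℕ i))) (padded y (suc (suc (toℕ i)))) ∎
  where
  I₀ I₊ I₋ : Fin n → ℚ
  I₀ k = indicator (toℕ i) (toℕ k) (q + 1ℚ)
  I₊ k = indicator (suc (toℕ i)) (toℕ k) (- 1ℚ)
  I₋ k = indicator (toℕ i) (suc (toℕ k)) (- q)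
  *-distribˡ-+₃ : ∀ a x y z → a * (x + y + z) ≡ a * x + a * y + a * z
  *-distribˡ-+₃ a x y z = trans (*-distribˡ-+ a (x + y) z) (cong (_+ a * z) (*-distribˡ-+ a x y))

nonneg-+ : ∀ {p r} → 0ℚ ≤ p → 0ℚ ≤ r → 0ℚ ≤ p + r
nonneg-+ = +-mono-≤

nonneg-* : ∀ {p r} → 0ℚ ≤ p → 0ℚ ≤ r → 0ℚ ≤ p * r
nonneg-* {p} {r} p≥0 r≥0 =
  nonNegative⁻¹ (p * r) {{nonNeg*nonNeg⇒nonNeg p {{nonNegative p≥0}} r {{nonNegative r≥0}}}}

p≤r⇒0≤r-p : ∀ {p r} → p ≤ r → 0ℚ ≤ r - p
p≤r⇒0≤r-p {p} {r} p≤r = subst (_≤ r - p) (+-inverseʳ p) (+-monoˡ-≤ (- p) p≤r)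

square-nonneg : ∀ x → 0ℚ ≤ x * x
square-nonneg x with ≤-total 0ℚ x
... | inj₁ x≥0 = nonneg-* x≥0 x≥0
... | inj₂ x≤0 = nonNegative⁻¹ (x * x) {{nonPos*nonPos⇒nonPos x {{nonPositive x≤0}} x {{nonPositive x≤0}}}}

square≡0⇒≡0 : ∀ x → x * x ≡ 0ℚ → x ≡ 0ℚ
square≡0⇒≡0 x x²≡0 with <-cmp x 0ℚ
... | tri< x<0 _ _ = ⊥-elim (<-irrefl (sym x²≡0)
                       (positive⁻¹ (x * x) {{neg*neg⇒pos x {{negative x<0}} x {{negative x<0}}}}))
... | tri≈ _ x≡0 _ = x≡0
... | tri> _ _ x>0 = ⊥-elim (<-irrefl (sym x²≡0)
                       (positive⁻¹ (x * x) {{pos*pos⇒pos x {{positive x>0}} x {{positive x>0}}}}))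

squares-step : ∀ {q c a b} → 0ℚ ≤ q → c * c ≤ a * a → a * rowA q c a b ≤ 0ℚ → a * a ≤ b * b
squares-step {q} {c} {a} {b} q≥0 c²≤a² aR≤0 =
  subst₂ _≤_ (+-identityʳ (a * a)) b²≡a²+X (+-monoʳ-≤ (a * a) X≥0)
  where
  R X : ℚ
  R = rowA q c a b
  X = (a - b) * (a - b) + q * ((a - c) * (a - c)) + q * (a * a - c * c) + (- (a * R) + - (a * R))
  X≥0 : 0ℚ ≤ X
  X≥0 = nonneg-+ (nonneg-+ (nonneg-+ (square-nonneg (a - b)) (nonneg-* q≥0 (square-nonneg (a - c))))
                           (nonneg-* q≥0 (p≤r⇒0≤r-p c²≤a²)))
                 (nonneg-+ (neg-antimono-≤ aR≤0) (neg-antimono-≤ aR≤0))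
  b²≡a²+X : a * a + X ≡ b * b
  b²≡a²+X = solve 4 (λ q a b c → let R = a :* (q :+ con 1ℚ) :+ b :* (:- con 1ℚ) :+ c :* (:- q) in
    a :* a :+ ((a :- b) :* (a :- b) :+ q :* ((a :- c) :* (a :- c)) :+ q :* (a :* a :- c :* c)
              :+ (:- (a :* R) :+ :- (a :* R)))
    := b :* b) refl q a b c

stepwise-≤ : ∀ (f : ℕ → ℚ) m → (∀ i → i ℕ.< m → f i ≤ f (suc i)) → ∀ i → i ℕ.≤ m → f i ≤ f m
stepwise-≤ f zero    step .zero ℕ.z≤n = ≤-refl
stepwise-≤ f (suc m) step i     i≤1+m with ℕₚ.m≤n⇒m<n∨m≡n i≤1+m
... | inj₁ (ℕ.s≤s i≤m) =
  ≤-trans (stepwise-≤ f m (λ j j<m → step j (ℕₚ.m<n⇒m<1+n j<m)) i i≤m) (step m ℕₚ.≤-refl)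
... | inj₂ refl        = ≤-refl

module _ {q : ℚ} (q≥0 : 0ℚ ≤ q) (n : ℕ) (W : ℕ → ℚ)
         (W₀≡0 : W 0 ≡ 0ℚ) (Wₙ₊₁≡0 : W (suc n) ≡ 0ℚ)
         (W·AW≤0 : ∀ i → i ℕ.< n → W (suc i) * rowA q (W i) (W (suc i)) (W (suc (suc i))) ≤ 0ℚ) where

  squares-nondecreasing : ∀ i → i ℕ.≤ n → W i * W i ≤ W (suc i) * W (suc i)
  squares-nondecreasing zero    _   = subst (_≤ W 1 * W 1) (sym (cong₂ _*_ W₀≡0 W₀≡0)) (square-nonneg (W 1))
  squares-nondecreasing (suc i) i<n =
    squares-step {c = W i} {W (suc i)} {W (suc (suc i))} q≥0
                 (squares-nondecreasing i (ℕₚ.<⇒≤ i<n)) (W·AW≤0 i i<n)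

  sequence-vanishes : ∀ i → i ℕ.≤ suc n → W i ≡ 0ℚ
  sequence-vanishes i i≤1+n = square≡0⇒≡0 (W i) (≤-antisym W²≤0 (square-nonneg (W i)))
    where
    W²≤0 : W i * W i ≤ 0ℚ
    W²≤0 = ≤-trans (stepwise-≤ (λ j → W j * W j) (suc n)
                               (λ j j<1+n → squares-nondecreasing j (ℕₚ.≤-pred j<1+n)) i i≤1+n)
                   (≤-reflexive (trans (cong₂ _*_ Wₙ₊₁≡0 Wₙ₊₁≡0) (*-zeroˡ 0ℚ)))

A-no-sign-reversal : ∀ {q} → 0ℚ ≤ q → (y : Fin n → ℚ) →
  (∀ i → y i * applyA q y i ≤ 0ℚ) → ∀ i → y i ≡ 0ℚ
A-no-sign-reversal {n = n} {q} q≥0 y y·Ay≤0 i = begin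
  y i                     ≡⟨ extend-toℕ y i ⟨
  padded y (suc (toℕ i))  ≡⟨ sequence-vanishes q≥0 n W refl (extend-beyond n y) W·AW≤0 (suc (toℕ i))
                                               (ℕₚ.m≤n⇒m≤1+n (Finₚ.toℕ<n i)) ⟩
  0ℚ                      ∎
  where
  W : ℕ → ℚ
  W = padded y
  W·AW≤0 : ∀ j → j ℕ.< n → W (suc j) * rowA q (W j) (W (suc j)) (W (suc (suc j))) ≤ 0ℚ
  W·AW≤0 j j<n = subst (λ t → W (suc t) * rowA q (W t) (W (suc t)) (W (suc (suc t))) ≤ 0ℚ) (Finₚ.toℕ-fromℕ< j<n)
    (subst₂ (λ u v → u * v ≤ 0ℚ) (sym (extend-toℕ y k)) (applyA-padded q y k) (y·Ay≤0 k))
    where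
    k : Fin n
    k = Fin.fromℕ< j<n

-- Generator lists of subfamilies

select : Subset m → (Fin m → T) → List T
select []            f = List.[]
select (inside ∷ J)  f = f zero List.∷ select J (f ∘ suc)
select (outside ∷ J) f = select J (f ∘ suc)

filter-map-suc : ∀ s (J : Subset m) (xs : List (Fin m)) →
  filter (_∈? (s ∷ J)) (List.map suc xs) ≡ List.map suc (filter (_∈? J) xs)
filter-map-suc s J List.[]        = refl
filter-map-suc s J (x List.∷ xs) with x ∈? J
... | yes _ = cong (suc x List.∷_) (filter-map-suc s J xs)
... | no  _ = filter-map-suc s J xs

map-filter≡select : (J : Subset m) (f : Fin m → T) → List.map f (filter (_∈? J) (allFin m)) ≡ select J f
map-filter-suc≡select : ∀ s (J : Subset m) (f : Fin (suc m) → T) →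
  List.map f (filter (_∈? (s ∷ J)) (tabulate suc)) ≡ select J (f ∘ suc)

map-filter≡select []            f = refl
map-filter≡select (inside ∷ J)  f = cong (f zero List.∷_) (map-filter-suc≡select inside J f)
map-filter≡select (outside ∷ J) f = map-filter-suc≡select outside J f
map-filter-suc≡select {m = m} s J f = begin
  List.map f (filter (_∈? (s ∷ J)) (tabulate suc))
    ≡⟨ cong (List.map f ∘ filter (_∈? (s ∷ J))) (map-tabulate id suc) ⟨
  List.map f (filter (_∈? (s ∷ J)) (List.map suc (allFin m)))
    ≡⟨ cong (List.map f) (filter-map-suc s J (allFin m)) ⟩
  List.map f (List.map suc (filter (_∈? J) (allFin m)))
    ≡⟨ map-∘ (filter (_∈? J) (allFin m)) ⟨
  List.map (f ∘ suc) (filter (_∈? J) (allFin m))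
    ≡⟨ map-filter≡select J (f ∘ suc) ⟩
  select J (f ∘ suc) ∎

length-select : (J : Subset m) (f : Fin m → T) → length (select J f) ≡ ∣ J ∣
length-select []            f = refl
length-select (inside ∷ J)  f = cong suc (length-select J (f ∘ suc))
length-select (outside ∷ J) f = length-select J (f ∘ suc)

Supported : Subset m → (Fin m → ℚ) → Set
Supported J a = ∀ i → i ∉ J → a i ≡ 0ℚ

-- Coefficients on select J f correspond to coefficient vectors on Fin m supported in J:
-- spread places them at their indices, gather reads them off.
spread : (J : Subset m) (f : Fin m → T) → (Fin (length (select J f)) → ℚ) → Fin m → ℚ
spread []            f c = λ ()
spread (inside ∷ J)  f c = c zero VF.∷ spread J (f ∘ suc) (c ∘ suc)
spread (outside ∷ J) f c = 0ℚ VF.∷ spread J (f ∘ suc) c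

gather : (J : Subset m) (f : Fin m → T) → (Fin m → ℚ) → Fin (length (select J f)) → ℚ
gather []            f a = λ ()
gather (inside ∷ J)  f a = a zero VF.∷ gather J (f ∘ suc) (a ∘ suc)
gather (outside ∷ J) f a = gather J (f ∘ suc) (a ∘ suc)

spread-supported : ∀ (J : Subset m) (f : Fin m → T) c → Supported J (spread J f c)
spread-supported (inside ∷ J)  f c zero    i∉J = contradiction here i∉J
spread-supported (inside ∷ J)  f c (suc i) i∉J = spread-supported J (f ∘ suc) (c ∘ suc) i (i∉J ∘ there)
spread-supported (outside ∷ J) f c zero    i∉J = refl
spread-supported (outside ∷ J) f c (suc i) i∉J = spread-supported J (f ∘ suc) c i (i∉J ∘ there)

module _ (P : Pred ℚ ℓ) where

  All-spread : ∀ (J : Subset m) (f : Fin m → T) {c} → P 0ℚ → All P c → All P (spread J f c)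
  All-spread (inside ∷ J)  f P0 Pc zero    = Pc zero
  All-spread (inside ∷ J)  f P0 Pc (suc i) = All-spread J (f ∘ suc) P0 (Pc ∘ suc) i
  All-spread (outside ∷ J) f P0 Pc zero    = P0
  All-spread (outside ∷ J) f P0 Pc (suc i) = All-spread J (f ∘ suc) P0 Pc i

  spread-All : ∀ (J : Subset m) (f : Fin m → T) {c} → All P (spread J f c) → All P c
  spread-All (inside ∷ J)  f Ps zero    = Ps zero
  spread-All (inside ∷ J)  f Ps (suc j) = spread-All J (f ∘ suc) (Ps ∘ suc) j
  spread-All (outside ∷ J) f Ps j       = spread-All J (f ∘ suc) (Ps ∘ suc) j

  All-gather : ∀ (J : Subset m) (f : Fin m → T) {a} → All P a → All P (gather J f a)
  All-gather (inside ∷ J)  f Pa zero    = Pa zero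
  All-gather (inside ∷ J)  f Pa (suc j) = All-gather J (f ∘ suc) (Pa ∘ suc) j
  All-gather (outside ∷ J) f Pa j       = All-gather J (f ∘ suc) (Pa ∘ suc) j

lincomb-select-spread : ∀ (J : Subset m) (f : Fin m → Vector n) c i →
  lincomb c (lookup (select J f)) i ≡ lincomb (spread J f c) f i
lincomb-select-spread []            f c i = refl
lincomb-select-spread (inside ∷ J)  f c i = cong (c zero * f zero i +_) (lincomb-select-spread J (f ∘ suc) (c ∘ suc) i)
lincomb-select-spread (outside ∷ J) f c i =
  trans (lincomb-select-spread J (f ∘ suc) c i) (sym (lincomb-head-zero (spread (outside ∷ J) f c) f refl i))

lincomb-select-gather : ∀ (J : Subset m) (f : Fin m → Vector n) {a} → Supported J a → ∀ i →
  lincomb (gather J f a) (lookup (select J f)) i ≡ lincomb a f i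
lincomb-select-gather []            f a∈J i = refl
lincomb-select-gather (inside ∷ J)  f {a} a∈J i =
  cong (a zero * f zero i +_) (lincomb-select-gather J (f ∘ suc) (λ k k∉J → a∈J (suc k) (k∉J ∘ drop-there)) i)
lincomb-select-gather (outside ∷ J) f {a} a∈J i =
  trans (lincomb-select-gather J (f ∘ suc) (λ k k∉J → a∈J (suc k) (k∉J ∘ drop-there)) i)
        (sym (lincomb-head-zero a f (a∈J zero λ ()) i))

splitˡ : (L₁ L₂ : List T) → (Fin (length (L₁ ++ L₂)) → ℚ) → Fin (length L₁) → ℚ
splitˡ List.[]        L₂ c = λ ()
splitˡ (x List.∷ L₁) L₂ c = c zero VF.∷ splitˡ L₁ L₂ (c ∘ suc)

splitʳ : (L₁ L₂ : List T) → (Fin (length (L₁ ++ L₂)) → ℚ) → Fin (length L₂) → ℚ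
splitʳ List.[]        L₂ c = c
splitʳ (x List.∷ L₁) L₂ c = splitʳ L₁ L₂ (c ∘ suc)

join : (L₁ L₂ : List T) → (Fin (length L₁) → ℚ) → (Fin (length L₂) → ℚ) →
       Fin (length (L₁ ++ L₂)) → ℚ
join List.[]        L₂ c₁ c₂ = c₂
join (x List.∷ L₁) L₂ c₁ c₂ = c₁ zero VF.∷ join L₁ L₂ (c₁ ∘ suc) c₂

module _ (P : Pred ℚ ℓ) where

  All-splitˡ : ∀ (L₁ L₂ : List T) {c} → All P c → All P (splitˡ L₁ L₂ c)
  All-splitˡ (x List.∷ L₁) L₂ Pc zero    = Pc zero
  All-splitˡ (x List.∷ L₁) L₂ Pc (suc j) = All-splitˡ L₁ L₂ (Pc ∘ suc) j

  All-splitʳ : ∀ (L₁ L₂ : List T) {c} → All P c → All P (splitʳ L₁ L₂ c)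
  All-splitʳ List.[]        L₂ Pc = Pc
  All-splitʳ (x List.∷ L₁) L₂ Pc = All-splitʳ L₁ L₂ (Pc ∘ suc)

  split-All : ∀ (L₁ L₂ : List T) {c} → All P (splitˡ L₁ L₂ c) → All P (splitʳ L₁ L₂ c) → All P c
  split-All List.[]        L₂ Pl Pr = Pr
  split-All (x List.∷ L₁) L₂ Pl Pr zero    = Pl zero
  split-All (x List.∷ L₁) L₂ Pl Pr (suc j) = split-All L₁ L₂ (Pl ∘ suc) Pr j

  All-join : ∀ (L₁ L₂ : List T) {c₁ c₂} → All P c₁ → All P c₂ → All P (join L₁ L₂ c₁ c₂)
  All-join List.[]        L₂ P₁ P₂ = P₂
  All-join (x List.∷ L₁) L₂ P₁ P₂ zero    = P₁ zero
  All-join (x List.∷ L₁) L₂ P₁ P₂ (suc j) = All-join L₁ L₂ (P₁ ∘ suc) P₂ j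

lincomb-++-split : ∀ (L₁ L₂ : List (Vector n)) c i → lincomb c (lookup (L₁ ++ L₂)) i ≡
  lincomb (splitˡ L₁ L₂ c) (lookup L₁) i + lincomb (splitʳ L₁ L₂ c) (lookup L₂) i
lincomb-++-split List.[]        L₂ c i = sym (+-identityˡ _)
lincomb-++-split (x List.∷ L₁) L₂ c i =
  trans (cong (c zero * x i +_) (lincomb-++-split L₁ L₂ (c ∘ suc) i)) (sym (+-assoc (c zero * x i) _ _))

lincomb-++-join : ∀ (L₁ L₂ : List (Vector n)) c₁ c₂ i → lincomb (join L₁ L₂ c₁ c₂) (lookup (L₁ ++ L₂)) i ≡
  lincomb c₁ (lookup L₁) i + lincomb c₂ (lookup L₂) i
lincomb-++-join List.[]        L₂ c₁ c₂ i = sym (+-identityˡ _)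
lincomb-++-join (x List.∷ L₁) L₂ c₁ c₂ i =
  trans (cong (c₁ zero * x i +_) (lincomb-++-join L₁ L₂ (c₁ ∘ suc) c₂ i)) (sym (+-assoc (c₁ zero * x i) _ _))

-- The cones σ_{J,K}

negα : ℚ → Fin n → Vector n
negα q k = negV (α q k)

gens : ℚ → Subset n → Subset n → List (Vector n)
gens q J K = select J e ++ select K (negα q)

gensList≡gens : ∀ q (J K : Subset n) → gensList q J K ≡ gens q J K
gensList≡gens q J K = cong₂ _++_ (map-filter≡select J e) (map-filter≡select K (negα q))

length-gens : ∀ q (J K : Subset n) → length (gens q J K) ≡ ∣ J ∣ ℕ.+ ∣ K ∣
length-gens q J K = trans (length-++ (select J e)) (cong₂ ℕ._+_ (length-select J e) (length-select K (negα q)))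

module _ (q : ℚ) (J K : Subset n) where
  private
    Lₑ Lα : List (Vector n)
    Lₑ = select J e
    Lα = select K (negα q)

  eCoeffs αCoeffs : (Fin (length (gens q J K)) → ℚ) → Fin n → ℚ
  eCoeffs c = spread J e (splitˡ Lₑ Lα c)
  αCoeffs c = spread K (negα q) (splitʳ Lₑ Lα c)

  lincomb-gens : ∀ c i → lincomb c (lookup (gens q J K)) i ≡ eCoeffs c i - applyA q (αCoeffs c) i
  lincomb-gens c i = begin
    lincomb c (lookup (gens q J K)) i
      ≡⟨ lincomb-++-split Lₑ Lα c i ⟩
    lincomb (splitˡ Lₑ Lα c) (lookup Lₑ) i + lincomb (splitʳ Lₑ Lα c) (lookup Lα) i
      ≡⟨ cong₂ _+_ (lincomb-select-spread J e (splitˡ Lₑ Lα c) i)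
                   (lincomb-select-spread K (negα q) (splitʳ Lₑ Lα c) i) ⟩
    lincomb (eCoeffs c) e i + lincomb (αCoeffs c) (negα q) i
      ≡⟨ cong₂ _+_ (lincomb-e (eCoeffs c) i) (lincomb-negV (αCoeffs c) (α q) i) ⟩
    eCoeffs c i - applyA q (αCoeffs c) i ∎

  gensCoeffs : (a b : Fin n → ℚ) → Fin (length (gens q J K)) → ℚ
  gensCoeffs a b = join Lₑ Lα (gather J e a) (gather K (negα q) b)

  lincomb-gensCoeffs : ∀ {a b} → Supported J a → Supported K b →
    ∀ i → lincomb (gensCoeffs a b) (lookup (gens q J K)) i ≡ a i - applyA q b i
  lincomb-gensCoeffs {a} {b} a∈J b∈K i = begin
    lincomb (gensCoeffs a b) (lookup (gens q J K)) i
      ≡⟨ lincomb-++-join Lₑ Lα (gather J e a) (gather K (negα q) b) i ⟩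
    lincomb (gather J e a) (lookup Lₑ) i + lincomb (gather K (negα q) b) (lookup Lα) i
      ≡⟨ cong₂ _+_ (lincomb-select-gather J e a∈J i) (lincomb-select-gather K (negα q) b∈K i) ⟩
    lincomb a e i + lincomb b (negα q) i
      ≡⟨ cong₂ _+_ (lincomb-e a i) (lincomb-negV b (α q) i) ⟩
    a i - applyA q b i ∎

record Coords (q : ℚ) (J K : Subset n) (x : Vector n) : Set where
  field
    a b    : Fin n → ℚ
    a≥0    : All (0ℚ ≤_) a
    b≥0    : All (0ℚ ≤_) b
    a∈J    : Supported J a
    b∈K    : Supported K b
    x≡a-Ab : ∀ i → x i ≡ a i - applyA q b i

  a≡x+Ab : ∀ i → a i ≡ x i + applyA q b i
  a≡x+Ab i = begin
    a i                                  ≡⟨ solve 2 (λ a s → a := (a :- s) :+ s) refl (a i) (applyA q b i) ⟩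
    (a i - applyA q b i) + applyA q b i  ≡⟨ cong (_+ applyA q b i) (x≡a-Ab i) ⟨
    x i + applyA q b i                   ∎

σ⇒Coords : ∀ {q} {J K : Subset n} {x} → σ q J K x → Coords q J K x
σ⇒Coords {q = q} {J} {K} {x} x∈σ with subst (λ L → Cone (lookup L) x) (gensList≡gens q J K) x∈σ
... | c , c≥0 , x≡c·gens = record
  { a      = eCoeffs q J K c
  ; b      = αCoeffs q J K c
  ; a≥0    = All-spread (0ℚ ≤_) J e ≤-refl (All-splitˡ (0ℚ ≤_) (select J e) (select K (negα q)) c≥0)
  ; b≥0    = All-spread (0ℚ ≤_) K (negα q) ≤-refl (All-splitʳ (0ℚ ≤_) (select J e) (select K (negα q)) c≥0)
  ; a∈J    = spread-supported J e _
  ; b∈K    = spread-supported K (negα q) _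
  ; x≡a-Ab = λ i → trans (x≡c·gens i) (lincomb-gens q J K c i)
  }

Coords⇒σ : ∀ {q} {J K : Subset n} {x} → Coords q J K x → σ q J K x
Coords⇒σ {q = q} {J} {K} {x} coords = subst (λ L → Cone (lookup L) x) (sym (gensList≡gens q J K))
  ( gensCoeffs q J K a b
  , All-join (0ℚ ≤_) (select J e) (select K (negα q))
             (All-gather (0ℚ ≤_) J e a≥0) (All-gather (0ℚ ≤_) K (negα q) b≥0)
  , λ i → trans (x≡a-Ab i) (sym (lincomb-gensCoeffs q J K a∈J b∈K i)))
  where open Coords coords

Supported-mono : ∀ {J K : Subset n} {a} → J ⊆ K → Supported J a → Supported K a
Supported-mono J⊆K a∈J i i∉K = a∈J i (i∉K ∘ J⊆K)

Supported-∩ : ∀ {J K : Subset n} {a} → Supported J a → Supported K a → Supported (J ∩ K) a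
Supported-∩ {J = J} a∈J a∈K i i∉J∩K with i ∈? J
... | yes i∈J = a∈K i λ i∈K → i∉J∩K (x∈p∩q⁺ (i∈J , i∈K))
... | no  i∉J = a∈J i i∉J

Supported-+ : ∀ {J : Subset n} {a a′} → Supported J a → Supported J a′ → Supported J (λ i → a i + a′ i)
Supported-+ a∈J a′∈J i i∉J = cong₂ _+_ (a∈J i i∉J) (a′∈J i i∉J)

disjoint-supports⇒*≡0 : ∀ {J K : Subset n} {a b} → Disjoint J K → Supported J a → Supported K b →
  ∀ i → a i * b i ≡ 0ℚ
disjoint-supports⇒*≡0 {J = J} {K} {a} {b} J∩K=∅ a∈J b∈K i with i ∈? J
... | yes i∈J = trans (cong (a i *_) (b∈K i λ i∈K → J∩K=∅ (i , x∈p∩q⁺ (i∈J , i∈K)))) (*-zeroʳ (a i))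
... | no  i∉J = trans (cong (_* b i) (a∈J i i∉J)) (*-zeroˡ (b i))

supported-Av⇒v≡0 : ∀ {q} {J K : Subset n} {u v} → 0ℚ ≤ q → Disjoint J K → Supported J u → Supported K v →
  (∀ i → u i ≡ applyA q v i) → ∀ i → v i ≡ 0ℚ
supported-Av⇒v≡0 {q = q} {u = u} {v} q≥0 J∩K=∅ u∈J v∈K u≡Av =
  A-no-sign-reversal q≥0 v λ i → ≤-reflexive (begin
  v i * applyA q v i  ≡⟨ cong (v i *_) (u≡Av i) ⟨
  v i * u i           ≡⟨ *-comm (v i) (u i) ⟩
  u i * v i           ≡⟨ disjoint-supports⇒*≡0 J∩K=∅ u∈J v∈K i ⟩
  0ℚ                  ∎)

nonneg-+≡0⇒≡0 : ∀ {p r} → 0ℚ ≤ p → 0ℚ ≤ r → p + r ≡ 0ℚ → p ≡ 0ℚ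
nonneg-+≡0⇒≡0 {p} {r} p≥0 r≥0 p+r≡0 =
  ≤-antisym (subst₂ _≤_ (+-identityʳ p) p+r≡0 (+-monoʳ-≤ p r≥0)) p≥0

complementary⇒*≤0 : ∀ {a b c d} → 0ℚ ≤ a → 0ℚ ≤ b → 0ℚ ≤ c → 0ℚ ≤ d → a * b ≡ 0ℚ → c * d ≡ 0ℚ →
  (b - d) * (a - c) ≤ 0ℚ
complementary⇒*≤0 {a} {b} {c} {d} a≥0 b≥0 c≥0 d≥0 ab≡0 cd≡0 =
  subst (_≤ 0ℚ) (sym expand) (neg-antimono-≤ (nonneg-+ (nonneg-* b≥0 c≥0) (nonneg-* d≥0 a≥0)))
  where
  expand : (b - d) * (a - c) ≡ - (b * c + d * a)
  expand = begin
    (b - d) * (a - c)                ≡⟨ solve 4 (λ a b c d → (b :- d) :* (a :- c) := a :* b :+ c :* d :- (b :* c :+ d :* a))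
                                                refl a b c d ⟩
    a * b + c * d - (b * c + d * a)  ≡⟨ cong (λ t → t - (b * c + d * a)) (cong₂ _+_ ab≡0 cd≡0) ⟩
    0ℚ - (b * c + d * a)             ≡⟨ +-identityˡ (- (b * c + d * a)) ⟩
    - (b * c + d * a)                ∎

gens-independent : ∀ {q} {J K : Subset n} → 0ℚ ≤ q → Disjoint J K → LinIndep (lookup (gens q J K))
gens-independent {q = q} {J} {K} q≥0 J∩K=∅ c c·gens≡0 =
  split-All (_≡ 0ℚ) (select J e) (select K (negα q))
            (spread-All (_≡ 0ℚ) J e a≡0) (spread-All (_≡ 0ℚ) K (negα q) b≡0)
  where
  a b : Fin _ → ℚ
  a = eCoeffs q J K c
  b = αCoeffs q J K c
  a≡Ab : ∀ i → a i ≡ applyA q b i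
  a≡Ab i = x∙y⁻¹≈ε⇒x≈y (a i) (applyA q b i) (trans (sym (lincomb-gens q J K c i)) (c·gens≡0 i))
  b≡0 : ∀ i → b i ≡ 0ℚ
  b≡0 = supported-Av⇒v≡0 q≥0 J∩K=∅ (spread-supported J e _) (spread-supported K (negα q) _) a≡Ab
  a≡0 : ∀ i → a i ≡ 0ℚ
  a≡0 i = trans (a≡Ab i) (lincomb-zero b (α q) b≡0 i)

σ-dim : ∀ {q} {J K : Subset n} → 0ℚ ≤ q → Disjoint J K → HasDim (σ q J K) (∣ J ∣ ℕ.+ ∣ K ∣)
σ-dim {q = q} {J} {K} q≥0 J∩K=∅ =
  subst (λ L → HasDim (Cone (lookup L)) (∣ J ∣ ℕ.+ ∣ K ∣)) (sym (gensList≡gens q J K))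
    (subst (HasDim (Cone (lookup (gens q J K)))) (length-gens q J K)
      (LinIndep⇒HasDim-Cone (lookup (gens q J K)) (gens-independent q≥0 J∩K=∅)))

σ-stronglyConvex : ∀ {q} {J K : Subset n} → 0ℚ ≤ q → Disjoint J K → StronglyConvex (σ q J K)
σ-stronglyConvex {q = q} q≥0 J∩K=∅ x x∈σ -x∈σ i = begin
  x i                 ≡⟨ x≡a-Ab i ⟩
  a i - applyA q b i  ≡⟨ cong₂ _-_ (a≡0 i) (lincomb-zero b (α q) b≡0 i) ⟩
  0ℚ                  ∎
  where
  open Coords (σ⇒Coords x∈σ)
  open Coords (σ⇒Coords -x∈σ) using ()
    renaming (a to a′; b to b′; a≥0 to a′≥0; b≥0 to b′≥0; a∈J to a′∈J; b∈K to b′∈K; a≡x+Ab to a′≡-x+Ab′)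
  a+a′≡A[b+b′] : ∀ i → a i + a′ i ≡ applyA q (λ k → b k + b′ k) i
  a+a′≡A[b+b′] i = begin
    a i + a′ i                                        ≡⟨ cong₂ _+_ (a≡x+Ab i) (a′≡-x+Ab′ i) ⟩
    (x i + applyA q b i) + (- x i + applyA q b′ i)  ≡⟨ solve 3 (λ x s s′ → (x :+ s) :+ (:- x :+ s′) := s :+ s′)
                                                              refl (x i) (applyA q b i) (applyA q b′ i) ⟩
    applyA q b i + applyA q b′ i                      ≡⟨ lincomb-+ b b′ (α q) i ⟨
    applyA q (λ k → b k + b′ k) i                     ∎
  b+b′≡0 : ∀ i → b i + b′ i ≡ 0ℚ
  b+b′≡0 = supported-Av⇒v≡0 q≥0 J∩K=∅ (Supported-+ a∈J a′∈J) (Supported-+ b∈K b′∈K) a+a′≡A[b+b′]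
  b≡0 : ∀ i → b i ≡ 0ℚ
  b≡0 i = nonneg-+≡0⇒≡0 (b≥0 i) (b′≥0 i) (b+b′≡0 i)
  a≡0 : ∀ i → a i ≡ 0ℚ
  a≡0 i = nonneg-+≡0⇒≡0 (a≥0 i) (a′≥0 i) (trans (a+a′≡A[b+b′] i) (lincomb-zero _ (α q) b+b′≡0 i))

Coords-mono : ∀ {q} {J J′ K K′ : Subset n} {x} → J ⊆ J′ → K ⊆ K′ → Coords q J K x → Coords q J′ K′ x
Coords-mono J⊆J′ K⊆K′ coords = record
  { a      = a
  ; b      = b
  ; a≥0    = a≥0
  ; b≥0    = b≥0
  ; a∈J    = Supported-mono J⊆J′ a∈J
  ; b∈K    = Supported-mono K⊆K′ b∈K
  ; x≡a-Ab = x≡a-Ab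
  }
  where open Coords coords

Coords-∩ : ∀ {q} {J K P Q : Subset n} {x} → 0ℚ ≤ q → Disjoint J K → Disjoint P Q →
  Coords q J K x → Coords q P Q x → Coords q (J ∩ P) (K ∩ Q) x
Coords-∩ {q = q} {x = x} q≥0 J∩K=∅ P∩Q=∅ coords₁ coords₂ = record
  { a      = a
  ; b      = b
  ; a≥0    = a≥0
  ; b≥0    = b≥0
  ; a∈J    = Supported-∩ a∈J (λ i i∉P → trans (a≡c i) (c∈P i i∉P))
  ; b∈K    = Supported-∩ b∈K (λ i i∉Q → trans (b≡d i) (d∈Q i i∉Q))
  ; x≡a-Ab = x≡a-Ab
  }
  where
  open Coords coords₁
  open Coords coords₂ using ()
    renaming (a to c; b to d; a≥0 to c≥0; b≥0 to d≥0; a∈J to c∈P; b∈K to d∈Q; a≡x+Ab to c≡x+Ad)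
  a-c≡A[b-d] : ∀ i → a i - c i ≡ applyA q (λ k → b k - d k) i
  a-c≡A[b-d] i = begin
    a i - c i                                    ≡⟨ cong₂ _-_ (a≡x+Ab i) (c≡x+Ad i) ⟩
    (x i + applyA q b i) - (x i + applyA q d i)  ≡⟨ solve 3 (λ x s s′ → (x :+ s) :- (x :+ s′) := s :- s′)
                                                          refl (x i) (applyA q b i) (applyA q d i) ⟩
    applyA q b i - applyA q d i                  ≡⟨ lincomb-sub b d (α q) i ⟨
    applyA q (λ k → b k - d k) i                 ∎
  b-d≡0 : ∀ i → b i - d i ≡ 0ℚ
  b-d≡0 = A-no-sign-reversal q≥0 (λ k → b k - d k) λ i →
    subst (λ t → (b i - d i) * t ≤ 0ℚ) (a-c≡A[b-d] i)
      (complementary⇒*≤0 (a≥0 i) (b≥0 i) (c≥0 i) (d≥0 i)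
        (disjoint-supports⇒*≡0 J∩K=∅ a∈J b∈K i) (disjoint-supports⇒*≡0 P∩Q=∅ c∈P d∈Q i))
  b≡d : ∀ i → b i ≡ d i
  b≡d i = x∙y⁻¹≈ε⇒x≈y (b i) (d i) (b-d≡0 i)
  a≡c : ∀ i → a i ≡ c i
  a≡c i = x∙y⁻¹≈ε⇒x≈y (a i) (c i) (trans (a-c≡A[b-d] i) (lincomb-zero _ (α q) b-d≡0 i))

σ-∩ : ∀ {q} {J K P Q : Subset n} → 0ℚ ≤ q → Disjoint J K → Disjoint P Q →
  (σ q J K ∩ᵥ σ q P Q) ≐ σ q (J ∩ P) (K ∩ Q)
σ-∩ {J = J} {K} {P} {Q} q≥0 J∩K=∅ P∩Q=∅ x =
  (λ (x∈σ₁ , x∈σ₂) → Coords⇒σ (Coords-∩ q≥0 J∩K=∅ P∩Q=∅ (σ⇒Coords x∈σ₁) (σ⇒Coords x∈σ₂))) ,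
  (λ x∈σ → Coords⇒σ (Coords-mono (p∩q⊆p J P) (p∩q⊆p K Q) (σ⇒Coords x∈σ)) ,
           Coords⇒σ (Coords-mono (p∩q⊆q J P) (p∩q⊆q K Q) (σ⇒Coords x∈σ)))

lemma3p2 : (n : ℕ) → 1 ℕ.≤ n → (q : ℚ) → Positive q →
    ((J K : Subset n) → Disjoint J K →
      RationalPolyhedral (σ q J K) × StronglyConvex (σ q J K) × HasDim (σ q J K) (∣ J ∣ ℕ.+ ∣ K ∣))
    × ((J K P Q : Subset n) → Disjoint J K → Disjoint P Q →
      (σ q J K ∩ᵥ σ q P Q) ≐ σ q (J ∩ P) (K ∩ Q))
lemma3p2 n _ q q>0 =
  (λ J K J∩K=∅ → (_ , _ , λ x → id , id) , σ-stronglyConvex q≥0 J∩K=∅ , σ-dim q≥0 J∩K=∅) ,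
  (λ J K P Q → σ-∩ q≥0)
  where
  q≥0 : 0ℚ ≤ q
  q≥0 = nonNegative⁻¹ q {{pos⇒nonNeg q {{q>0}}}}
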